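{- Let $D_0$ be a dag with topological ordering $\phi=v_1,\ldots,v_n$, and let $\Delta$ be an upper bound on all in- and outdegrees in $D_0$. Then there is a well-connected dag $D$ on the same vertices, in which every vertex has the same indegree and outdegree as in $D_0$, such that $\phi$ is a topological ordering of $D$. Furthermore, writing $p_i$ for the potential of $D$ at position $i$ with respect to $\phi$ and $d^-(v),d^+(v)$ for in/outdegrees, for all $1<i\le n$ and $1\le j\le\Delta$: $$p_i[j]=\begin{cases} p_{i-1}[j] & \text{if } j<\Delta \text{ and } p_{i-1}[j+1]\ge d^-(v_i),\\ p_{i-1}[j]-(d^-(v_i)-p_{i-1}[j+1]) & \text{if } j<\Delta \text{ and } p_{i-1}[j+1]<d^-(v_i)\le p_{i-1}[j],\\ p_{i-1}[j+1] & \text{if } j<\Delta \text{ and } p_{i-1}[j]<d^-(v_i),\\ \max\{0,p_{i-1}[j]-d^-(v_i)\} & \text{if } j=\Delta,\end{cases}\ +\ \begin{cases}1 & \text{if } d^+(v_i)\ge j,\\ 0 & \text{otherwise.}\end{cases}$$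
   Context: A dag is a directed acyclic graph without parallel arcs and self-loops. A topological ordering of a dag is an ordering $v_1,\ldots,v_n$ of all its vertices such that every arc $(v_i,v_j)$ satisfies $i<j$. For a dag $D$ with topological ordering $v_1,\ldots,v_n$ and $0\le i\le n$, the potential at position $i$ is the vector $p_i\in\mathbb{N}^\Delta$ where $p_i[l]$ ($1\le l\le\Delta$) is the number of vertices among $v_1,\ldots,v_i$ that have at least $l$ neighbors among $v_{i+1},\ldots,v_n$. The remaining outdegree at position $j$ of a vertex $v_i$ ($i\le j$) is the number of its neighbors in $v_j,\ldots,v_n$. $D$ is well-connected (with respect to the ordering) if every vertex $v_i$ has as its in-neighbors the $d^-(v_i)$ vertices among $v_1,\ldots,v_{i-1}$ with the highest remaining outdegree at position $i-1$. -}

module Defs where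

open import Data.Nat using (ℕ; zero; suc; _+_; _∸_; _≤_; _<_; _≤ᵇ_; _<ᵇ_)
open import Data.Fin using (Fin; toℕ; zero; suc)
open import Data.Bool using (Bool; true; false; if_then_else_; _∧_; not)
open import Relation.Binary.PropositionalEquality using (_≡_)

-- Vertices of a dag on n vertices are identified with positions in the fixed
-- topological ordering φ = v₁,…,vₙ : the vertex with index k : Fin n is v_{k+1}.
-- A dag for which φ is a topological ordering is a simple arc relation in
-- which every arc goes forward in φ (this excludes self-loops and cycles;
-- parallel arcs are impossible since arcs form a relation).
record Dag (n : ℕ) : Set where
  field
    arc     : Fin n → Fin n → Bool
    forward : ∀ u v → arc u v ≡ true → toℕ u < toℕ v
open Dag public

count : ∀ {n} → (Fin n → Bool) → ℕ
count {zero}  P = 0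
count {suc n} P = (if P zero then 1 else 0) + count (λ k → P (suc k))

indeg : ∀ {n} → Dag n → Fin n → ℕ
indeg D v = count (λ u → arc D u v)

outdeg : ∀ {n} → Dag n → Fin n → ℕ
outdeg D u = count (λ v → arc D u v)

-- remaining outdegree of vertex u after position p (p = 0,…,n):
-- number of out-neighbours of u among v_{p+1},…,v_n (indices ≥ p).
remOut : ∀ {n} → Dag n → ℕ → Fin n → ℕ
remOut D p u = count (λ v → (p ≤ᵇ toℕ v) ∧ arc D u v)

-- potential at position i (0 ≤ i ≤ n), coordinate l:
-- number of vertices among v₁,…,v_i with at least l neighbours among v_{i+1},…,v_n.
pot : ∀ {n} → Dag n → ℕ → ℕ → ℕ
pot D i l = count (λ u → (toℕ u <ᵇ i) ∧ (l ≤ᵇ remOut D i u))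

-- well-connected w.r.t. φ: every vertex v_{t+1} (index t) has as in-neighbours
-- the d⁻ vertices among v₁,…,v_t with highest remaining outdegree at position t
-- (i.e. counting neighbours among v_{t+1},…,v_n).  Ties may be broken arbitrarily:
-- every in-neighbour has remaining outdegree ≥ that of every earlier non-in-neighbour.
WellConnected : ∀ {n} → Dag n → Set
WellConnected {n} D =
  ∀ (v u w : Fin n) → arc D u v ≡ true → toℕ w < toℕ v → arc D w v ≡ false →
  remOut D (toℕ v) w ≤ remOut D (toℕ v) u

ind≤ : ℕ → ℕ → ℕ
ind≤ j d = if j ≤ᵇ d then 1 else 0

-- Well-connectedness is achieved one vertex at a time along φ. If vertex k violates it, some
-- in-neighbour u of k has smaller remaining outdegree than an earlier non-in-neighbour w, so w has
-- an out-neighbour x after k that u lacks. Replacing the arcs u→k, w→x by w→k, u→x keeps every in-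
-- and outdegree, every arc into a vertex before k and every remaining outdegree at positions up to
-- k, and strictly lowers the total remaining outdegree of the non-in-neighbours of k (the deficit);
-- so finitely many such exchanges make k well-connected without disturbing earlier vertices.
--
-- For the recurrence, split the vertices before k into its in-neighbours, whose remaining outdegree
-- drops by one when passing k, and the others, whose remaining outdegree is unchanged; k itself
-- enters the potential with its full outdegree. Well-connectedness says that as soon as some other
-- vertex has remaining outdegree ≥ s, all d⁻(k) in-neighbours do, and the four cases are then
-- arithmetic on the two counts.

module Submission where

open import Defs
open import Data.Nat using (ℕ; zero; suc; _+_; _∸_; _≤_; _<_; _≤ᵇ_; _<ᵇ_; z≤n; s≤s; _<?_)
open import Data.Nat.Induction using (<-wellFounded)
open import Induction.WellFounded using (Acc; acc)
open import Relation.Binary using (tri<; tri≈; tri>)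
open import Data.Nat.Properties
open import Data.Fin using (Fin; toℕ; zero; suc; punchIn; fromℕ<)
open import Data.Fin.Properties using (punchInᵢ≢i; toℕ-injective; toℕ-fromℕ<; toℕ<n; any?) renaming (_≟_ to _≟ᶠ_)
open import Data.Bool using (Bool; true; false; if_then_else_; _∧_; not; T)
open import Data.Bool.Properties using (¬-not; ∧-zeroʳ; not-involutive) renaming (_≟_ to _≟ᵇ_)
open import Data.Unit using (tt)
open import Data.Product using (Σ; ∃; _×_; _,_; proj₁; proj₂) renaming (map to map-Σ)
open import Data.Sum using (_⊎_; inj₁; inj₂)
open import Function using (_∘_; id)
open import Relation.Nullary using (¬_; Dec; yes; no; does; contradiction)
open import Relation.Nullary.Decidable using (_×-dec_; _⊎-dec_; dec-true; dec-false)
open import Relation.Binary.PropositionalEquality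
open import Algebra.Properties.CommutativeMonoid.Sum +-0-commutativeMonoid
  using (sum; sum-remove; sum-cong-≗)
open import Algebra.Properties.CommutativeSemigroup +-commutativeSemigroup
  using (xy∙z≈xz∙y; xy∙z≈zy∙x; interchange)

ind : Bool → ℕ
ind b = if b then 1 else 0

∧-intro : ∀ {x y} → x ≡ true → y ≡ true → x ∧ y ≡ true
∧-intro refl refl = refl

∧-elim : ∀ {x y} → x ∧ y ≡ true → x ≡ true × y ≡ true
∧-elim {true} {true} _ = refl , refl

≤ᵇ-true : ∀ {m n} → m ≤ n → (m ≤ᵇ n) ≡ true
≤ᵇ-true m≤n = T⇒≡ (≤⇒≤ᵇ m≤n)
  where T⇒≡ : ∀ {b} → T b → b ≡ true
        T⇒≡ {true} _ = refl

≤ᵇ-sound : ∀ {m n} → (m ≤ᵇ n) ≡ true → m ≤ n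
≤ᵇ-sound {m} {n} m≤ᵇn = ≤ᵇ⇒≤ m n (subst T (sym m≤ᵇn) tt)

<ᵇ-sound : ∀ {m n} → (m <ᵇ n) ≡ true → m < n
<ᵇ-sound {m} = ≤ᵇ-sound {suc m}

≤ᵇ-false : ∀ {m n} → n < m → (m ≤ᵇ n) ≡ false
≤ᵇ-false {m} {n} n<m = ¬-not (λ m≤ᵇn → <⇒≱ n<m (≤ᵇ-sound m≤ᵇn))

<ᵇ-true : ∀ {m n} → m < n → (m <ᵇ n) ≡ true
<ᵇ-true = ≤ᵇ-true

<ᵇ-false : ∀ {m n} → n ≤ m → (m <ᵇ n) ≡ false
<ᵇ-false = ≤ᵇ-false ∘ s≤s

suc-≤ᵇ-suc : ∀ {m n} → (suc m ≤ᵇ suc n) ≡ (m ≤ᵇ n)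
suc-≤ᵇ-suc {zero}  = refl
suc-≤ᵇ-suc {suc m} = refl

≤ᵇ-suc : ∀ {m n} → m ≢ n → (m ≤ᵇ n) ≡ (suc m ≤ᵇ n)
≤ᵇ-suc {m} {n} m≢n with <-cmp m n
... | tri< m<n _ _   = trans (≤ᵇ-true (<⇒≤ m<n)) (sym (≤ᵇ-true m<n))
... | tri≈ _ m≡n _   = contradiction m≡n m≢n
... | tri> _ _ n<m   = trans (≤ᵇ-false n<m) (sym (≤ᵇ-false (m<n⇒m<1+n n<m)))

sum-update : ∀ {n} (f g : Fin n → ℕ) (a : Fin n) → (∀ y → y ≢ a → f y ≡ g y) →
  sum f + g a ≡ sum g + f a
sum-update {suc n} f g a agree = begin
  sum f + g a                                  ≡⟨ cong (_+ g a) (sum-remove f) ⟩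
  f a + sum (f ∘ punchIn a) + g a              ≡⟨ cong (λ s → f a + s + g a) off-a ⟩
  f a + sum (g ∘ punchIn a) + g a              ≡⟨ xy∙z≈zy∙x (f a) _ (g a) ⟩
  g a + sum (g ∘ punchIn a) + f a              ≡⟨ cong (_+ f a) (sum-remove g) ⟨
  sum g + f a                                  ∎
  where
    open ≡-Reasoning
    off-a : sum (f ∘ punchIn a) ≡ sum (g ∘ punchIn a)
    off-a = sum-cong-≗ (λ j → agree (punchIn a j) (punchInᵢ≢i a j))

sum-exchange : ∀ {n} (f g : Fin n → ℕ) {a b : Fin n} → a ≢ b →
  (∀ y → y ≢ a → y ≢ b → f y ≡ g y) → sum f + (g a + g b) ≡ sum g + (f a + f b)
sum-exchange f g {a} {b} a≢b agree = begin
  sum f + (g a + g b)    ≡⟨ +-assoc (sum f) (g a) (g b) ⟨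
  sum f + g a + g b      ≡⟨ cong (λ z → sum f + z + g b) h-a ⟨
  sum f + h a + g b      ≡⟨ cong (_+ g b) (sum-update f h a f≡h) ⟩
  sum h + f a + g b      ≡⟨ xy∙z≈xz∙y (sum h) (f a) (g b) ⟩
  sum h + g b + f a      ≡⟨ cong (_+ f a) (sum-update h g b h≡g) ⟩
  sum g + h b + f a      ≡⟨ cong (λ z → sum g + z + f a) (h-at b (a≢b ∘ sym)) ⟩
  sum g + f b + f a      ≡⟨ xy∙z≈xz∙y (sum g) (f b) (f a) ⟩
  sum g + f a + f b      ≡⟨ +-assoc (sum g) (f a) (f b) ⟩
  sum g + (f a + f b)    ∎
  where
    open ≡-Reasoning
    h : Fin _ → ℕ
    h y = if does (y ≟ᶠ a) then g y else f y
    h-a : h a ≡ g a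
    h-a with a ≟ᶠ a
    ... | yes _   = refl
    ... | no a≢a  = contradiction refl a≢a
    h-at : ∀ y → y ≢ a → h y ≡ f y
    h-at y y≢a with y ≟ᶠ a
    ... | yes y≡a = contradiction y≡a y≢a
    ... | no _    = refl
    f≡h : ∀ y → y ≢ a → f y ≡ h y
    f≡h y y≢a = sym (h-at y y≢a)
    h≡g : ∀ y → y ≢ b → h y ≡ g y
    h≡g y y≢b with y ≟ᶠ a
    ... | yes _   = refl
    ... | no y≢a  = agree y y≢a y≢b

count-cong : ∀ {n} {P Q : Fin n → Bool} → (∀ y → P y ≡ Q y) → count P ≡ count Q
count-cong {zero}  P≡Q = refl
count-cong {suc n} P≡Q = cong₂ _+_ (cong ind (P≡Q zero)) (count-cong (P≡Q ∘ suc))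

count-as-sum : ∀ {n} (P : Fin n → Bool) → count P ≡ sum (ind ∘ P)
count-as-sum {zero}  P = refl
count-as-sum {suc n} P = cong (ind (P zero) +_) (count-as-sum (P ∘ suc))

count-update : ∀ {n} (P Q : Fin n → Bool) (a : Fin n) → (∀ y → y ≢ a → P y ≡ Q y) →
  count P + ind (Q a) ≡ count Q + ind (P a)
count-update P Q a agree = begin
  count P + ind (Q a)      ≡⟨ cong (_+ ind (Q a)) (count-as-sum P) ⟩
  sum (ind ∘ P) + ind (Q a) ≡⟨ sum-update (ind ∘ P) (ind ∘ Q) a (λ y → cong ind ∘ agree y) ⟩
  sum (ind ∘ Q) + ind (P a) ≡⟨ cong (_+ ind (P a)) (count-as-sum Q) ⟨
  count Q + ind (P a)      ∎
  where open ≡-Reasoning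

count-exchange : ∀ {n} (P Q : Fin n → Bool) {a b : Fin n} → a ≢ b →
  P a ≡ true → P b ≡ false → Q a ≡ false → Q b ≡ true →
  (∀ y → y ≢ a → y ≢ b → P y ≡ Q y) → count P ≡ count Q
count-exchange P Q {a} {b} a≢b Pa Pb Qa Qb agree = +-cancelʳ-≡ 1 (count P) (count Q) (begin
  count P + 1                               ≡⟨ cong₂ _+_ (count-as-sum P) (sym (indicators Qa Qb)) ⟩
  sum (ind ∘ P) + (ind (Q a) + ind (Q b))   ≡⟨ sum-exchange (ind ∘ P) (ind ∘ Q) a≢b (λ y y≢a → cong ind ∘ agree y y≢a) ⟩
  sum (ind ∘ Q) + (ind (P a) + ind (P b))   ≡⟨ cong₂ _+_ (sym (count-as-sum Q)) (indicators Pa Pb) ⟩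
  count Q + 1                               ∎)
  where
    open ≡-Reasoning
    indicators : ∀ {x y x′ y′} → x ≡ x′ → y ≡ y′ → ind x + ind y ≡ ind x′ + ind y′
    indicators = cong₂ (λ x y → ind x + ind y)

count-zero : ∀ {n} {P : Fin n → Bool} → (∀ y → P y ≡ false) → count P ≡ 0
count-zero {zero}      _      = refl
count-zero {suc n} {P} P≡false rewrite P≡false zero = count-zero (P≡false ∘ suc)

count-peel : ∀ {n} (P Q : Fin n → Bool) (a : Fin n) → (∀ y → y ≢ a → P y ≡ Q y) →
  Q a ≡ false → count P ≡ count Q + ind (P a)
count-peel P Q a agree Qa≡false = begin
  count P               ≡⟨ +-identityʳ (count P) ⟨
  count P + ind false   ≡⟨ cong (λ q → count P + ind q) Qa≡false ⟨
  count P + ind (Q a)   ≡⟨ count-update P Q a agree ⟩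
  count Q + ind (P a)   ∎
  where open ≡-Reasoning

count-split : ∀ {n} (P Q : Fin n → Bool) →
  count P ≡ count (λ y → P y ∧ Q y) + count (λ y → P y ∧ not (Q y))
count-split {zero}  P Q = refl
count-split {suc n} P Q =
  trans (cong₂ _+_ (split-head (P zero) (Q zero)) (count-split (P ∘ suc) (Q ∘ suc)))
        (interchange (ind (P zero ∧ Q zero)) (ind (P zero ∧ not (Q zero)))
                     (count {n} (λ y → P (suc y) ∧ Q (suc y)))
                     (count {n} (λ y → P (suc y) ∧ not (Q (suc y)))))
  where
    split-head : ∀ p q → ind p ≡ ind (p ∧ q) + ind (p ∧ not q)
    split-head true  true  = refl
    split-head true  false = refl
    split-head false _     = refl

count-mono : ∀ {n} {P Q : Fin n → Bool} → (∀ y → P y ≡ true → Q y ≡ true) → count P ≤ count Q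
count-mono {zero}          _   = z≤n
count-mono {suc n} {P} {Q} P⇒Q = +-mono-≤ (ind-mono (P zero) (Q zero) (P⇒Q zero)) (count-mono (P⇒Q ∘ suc))
  where
    ind-mono : ∀ p q → (p ≡ true → q ≡ true) → ind p ≤ ind q
    ind-mono false _     _   = z≤n
    ind-mono true  true  _   = ≤-refl
    ind-mono true  false p⇒q with () ← p⇒q refl

count-∧-≤ : ∀ {n} (P Q : Fin n → Bool) → count (λ y → P y ∧ Q y) ≤ count Q
count-∧-≤ P Q = count-mono (λ y → proj₂ ∘ ∧-elim {P y})

count-witness : ∀ {n} (P Q : Fin n → Bool) → count Q < count P →
  ∃ λ y → P y ≡ true × Q y ≡ false
count-witness {suc n} P Q Q<P with P zero in P₀ | Q zero in Q₀
... | true  | false = zero , P₀ , Q₀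
... | true  | true  = map-Σ suc id (count-witness (P ∘ suc) (Q ∘ suc) (≤-pred Q<P))
... | false | false = map-Σ suc id (count-witness (P ∘ suc) (Q ∘ suc) Q<P)
... | false | true  = map-Σ suc id (count-witness (P ∘ suc) (Q ∘ suc) (<-trans (n<1+n _) Q<P))

count-nonzero : ∀ {n} (P : Fin n → Bool) → count P ≢ 0 → ∃ λ y → P y ≡ true
count-nonzero {n} P P≢0 = map-Σ id proj₁ (count-witness P (λ _ → false)
  (subst (_< count P) (sym (count-zero {n} (λ _ → refl))) (n≢0⇒n>0 P≢0)))

count-from : ∀ {n} (k : Fin n) (f : Fin n → Bool) →
  count (λ v → (toℕ k ≤ᵇ toℕ v) ∧ f v) ≡ ind (f k) + count (λ v → (suc (toℕ k) ≤ᵇ toℕ v) ∧ f v)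
count-from k f = begin
  count P               ≡⟨ count-peel P Q k agree (cong (_∧ f k) (≤ᵇ-false (n<1+n (toℕ k)))) ⟩
  count Q + ind (P k)   ≡⟨ cong (λ b → count Q + ind (b ∧ f k)) (≤ᵇ-true (≤-refl {toℕ k})) ⟩
  count Q + ind (f k)   ≡⟨ +-comm (count Q) (ind (f k)) ⟩
  ind (f k) + count Q   ∎
  where
    open ≡-Reasoning
    P Q : Fin _ → Bool
    P v = (toℕ k ≤ᵇ toℕ v) ∧ f v
    Q v = (suc (toℕ k) ≤ᵇ toℕ v) ∧ f v
    agree : ∀ v → v ≢ k → P v ≡ Q v
    agree v v≢k = cong (_∧ f v) (≤ᵇ-suc (v≢k ∘ toℕ-injective ∘ sym))

count-before : ∀ {n} (k : Fin n) (f : Fin n → Bool) →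
  count (λ u → (toℕ u <ᵇ suc (toℕ k)) ∧ f u) ≡ count (λ u → (toℕ u <ᵇ toℕ k) ∧ f u) + ind (f k)
count-before k f = begin
  count P               ≡⟨ count-peel P Q k agree (cong (_∧ f k) (<ᵇ-false (≤-refl {toℕ k}))) ⟩
  count Q + ind (P k)   ≡⟨ cong (λ b → count Q + ind (b ∧ f k)) (<ᵇ-true (n<1+n (toℕ k))) ⟩
  count Q + ind (f k)   ∎
  where
    open ≡-Reasoning
    P Q : Fin _ → Bool
    P u = (toℕ u <ᵇ suc (toℕ k)) ∧ f u
    Q u = (toℕ u <ᵇ toℕ k) ∧ f u
    agree : ∀ u → u ≢ k → P u ≡ Q u
    agree u u≢k = cong (_∧ f u) (trans (suc-≤ᵇ-suc {toℕ u}) (≤ᵇ-suc (u≢k ∘ toℕ-injective)))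

m+n≡o+n∸[o∸m] : ∀ {m o} n → m ≤ o → m + n ≡ (o + n) ∸ (o ∸ m)
m+n≡o+n∸[o∸m] {m} {o} n m≤o = begin
  m + n                   ≡⟨ +-comm m n ⟩
  n + m                   ≡⟨ cong (n +_) (m∸[m∸n]≡n m≤o) ⟨
  n + (o ∸ (o ∸ m))       ≡⟨ +-∸-assoc n (m∸n≤m o m) ⟨
  (n + o) ∸ (o ∸ m)       ≡⟨ cong (_∸ (o ∸ m)) (+-comm n o) ⟩
  (o + n) ∸ (o ∸ m)       ∎
  where open ≡-Reasoning

-- Read a s and b s as the numbers of earlier in-neighbours and of other earlier vertices with
-- remaining outdegree ≥ s; then a (suc j) + b j is the potential after the step.
module ThresholdSplit
  (a b p : ℕ → ℕ) (d : ℕ)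
  (p≡a+b      : ∀ s → p s ≡ a s + b s)
  (a≤d        : ∀ s → a s ≤ d)
  (a-antitone : ∀ s → a (suc s) ≤ a s)
  (b-antitone : ∀ s → b (suc s) ≤ b s)
  (threshold  : ∀ s → b s ≡ 0 ⊎ a s ≡ d)
  where

  p≡a : ∀ {s} → b s ≡ 0 → p s ≡ a s
  p≡a {s} b≡0 = trans (p≡a+b s) (trans (cong (a s +_) b≡0) (+-identityʳ (a s)))

  a≤p : ∀ s → a s ≤ p s
  a≤p s = subst (a s ≤_) (sym (p≡a+b s)) (m≤m+n (a s) (b s))

  saturated : ∀ {s} → d ≤ p s → a s ≡ d
  saturated {s} d≤p with threshold s
  ... | inj₁ b≡0 = ≤-antisym (a≤d s) (subst (d ≤_) (p≡a b≡0) d≤p)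
  ... | inj₂ a≡d = a≡d

  b-vanishes : ∀ {s} → p s < d → b s ≡ 0
  b-vanishes {s} p<d with threshold s
  ... | inj₁ b≡0 = b≡0
  ... | inj₂ a≡d = contradiction (subst (_≤ p s) a≡d (a≤p s)) (<⇒≱ p<d)

  step-above : ∀ {j} → d ≤ p (suc j) → a (suc j) + b j ≡ p j
  step-above {j} d≤p = begin
    a (suc j) + b j   ≡⟨ cong (_+ b j) a-stable ⟩
    a j + b j         ≡⟨ p≡a+b j ⟨
    p j               ∎
    where
      open ≡-Reasoning
      a-stable : a (suc j) ≡ a j
      a-stable = ≤-antisym (a-antitone j) (subst (a j ≤_) (sym (saturated d≤p)) (a≤d j))

  step-between : ∀ {j} → p (suc j) < d → d ≤ p j → a (suc j) + b j ≡ p j ∸ (d ∸ p (suc j))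
  step-between {j} p<d d≤p = begin
    a (suc j) + b j                     ≡⟨ m+n≡o+n∸[o∸m] (b j) (a≤d (suc j)) ⟩
    (d + b j) ∸ (d ∸ a (suc j))         ≡⟨ cong₂ (λ x y → (x + b j) ∸ (d ∸ y)) (saturated d≤p) (p≡a (b-vanishes p<d)) ⟨
    (a j + b j) ∸ (d ∸ p (suc j))       ≡⟨ cong (_∸ (d ∸ p (suc j))) (p≡a+b j) ⟨
    p j ∸ (d ∸ p (suc j))               ∎
    where open ≡-Reasoning

  step-below : ∀ {j} → p j < d → a (suc j) + b j ≡ p (suc j)
  step-below {j} p<d = begin
    a (suc j) + b j         ≡⟨ cong (a (suc j) +_) (trans b≡0 (sym b′≡0)) ⟩
    a (suc j) + b (suc j)   ≡⟨ p≡a+b (suc j) ⟨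
    p (suc j)               ∎
    where
      open ≡-Reasoning
      b≡0 : b j ≡ 0
      b≡0 = b-vanishes p<d
      b′≡0 : b (suc j) ≡ 0
      b′≡0 = n≤0⇒n≡0 (subst (b (suc j) ≤_) b≡0 (b-antitone j))

  step-top : ∀ {j} → a (suc j) ≡ 0 → a (suc j) + b j ≡ p j ∸ d
  step-top {j} a′≡0 = begin
    a (suc j) + b j     ≡⟨ cong (_+ b j) a′≡0 ⟩
    b j                 ≡⟨ b≡a+b∸d (threshold j) ⟩
    (a j + b j) ∸ d     ≡⟨ cong (_∸ d) (p≡a+b j) ⟨
    p j ∸ d             ∎
    where
      open ≡-Reasoning
      b≡a+b∸d : b j ≡ 0 ⊎ a j ≡ d → b j ≡ (a j + b j) ∸ d
      b≡a+b∸d (inj₁ b≡0) rewrite b≡0 = sym (m≤n⇒m∸n≡0 (subst (_≤ d) (sym (+-identityʳ (a j))) (a≤d j)))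
      b≡a+b∸d (inj₂ a≡d) rewrite a≡d = sym (m+n∸m≡n d (b j))

SameDegrees : ∀ {n} → Dag n → Dag n → Set
SameDegrees {n} D D₀ = ∀ (v : Fin n) → indeg D v ≡ indeg D₀ v × outdeg D v ≡ outdeg D₀ v

WellConnectedAt : ∀ {n} → Dag n → Fin n → Set
WellConnectedAt D v = ∀ u w → arc D u v ≡ true → toℕ w < toℕ v → arc D w v ≡ false →
  remOut D (toℕ v) w ≤ remOut D (toℕ v) u

WellConnectedBelow : ∀ {n} → ℕ → Dag n → Set
WellConnectedBelow t D = ∀ v → toℕ v < t → WellConnectedAt D v

SameDegrees-refl : ∀ {n} {D : Dag n} → SameDegrees D D
SameDegrees-refl v = refl , refl

SameDegrees-trans : ∀ {n} {D₁ D₂ D₃ : Dag n} → SameDegrees D₁ D₂ → SameDegrees D₂ D₃ → SameDegrees D₁ D₃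
SameDegrees-trans s₁₂ s₂₃ v = trans (proj₁ (s₁₂ v)) (proj₁ (s₂₃ v)) , trans (proj₂ (s₁₂ v)) (proj₂ (s₂₃ v))

wellConnectedBelow-suc : ∀ {n} {D : Dag n} {k} →
  WellConnectedBelow (toℕ k) D → WellConnectedAt D k → WellConnectedBelow (suc (toℕ k)) D
wellConnectedBelow-suc wc wck v v<1+k with m<1+n⇒m<n∨m≡n v<1+k
... | inj₁ v<k = wc v v<k
... | inj₂ v≡k with toℕ-injective v≡k
...   | refl = wck

remOut-<-witness : ∀ {n} (D : Dag n) p {u w} → remOut D p u < remOut D p w →
  ∃ λ x → p ≤ toℕ x × arc D w x ≡ true × arc D u x ≡ false
remOut-<-witness D p {u} {w} u<w
  with count-witness (λ z → (p ≤ᵇ toℕ z) ∧ arc D w z) (λ z → (p ≤ᵇ toℕ z) ∧ arc D u z) u<w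
... | x , counted-w , uncounted-u with ∧-elim {p ≤ᵇ toℕ x} counted-w
...   | p≤ᵇx , w→x = x , ≤ᵇ-sound {p} p≤ᵇx , w→x , trans (cong (_∧ arc D u x) (sym p≤ᵇx)) uncounted-u

remOut≤outdeg : ∀ {n} (D : Dag n) p u → remOut D p u ≤ outdeg D u
remOut≤outdeg D p u = count-∧-≤ (λ v → p ≤ᵇ toℕ v) (arc D u)

remOut-after-self : ∀ {n} (D : Dag n) k → remOut D (suc (toℕ k)) k ≡ outdeg D k
remOut-after-self D k = count-cong only-later
  where
    only-later : ∀ v → (suc (toℕ k) ≤ᵇ toℕ v) ∧ arc D k v ≡ arc D k v
    only-later v with arc D k v in k→v
    ... | true  = cong (_∧ true) (≤ᵇ-true (forward D k v k→v))
    ... | false = ∧-zeroʳ _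

module PotentialSplit {n} (D : Dag n) (k : Fin n) where

  t : ℕ
  t = toℕ k

  remOut-step : ∀ u → remOut D t u ≡ ind (arc D u k) + remOut D (suc t) u
  remOut-step u = count-from k (arc D u)

  counted : (Fin n → Bool) → ℕ → Fin n → Bool
  counted c s u = ((toℕ u <ᵇ t) ∧ (s ≤ᵇ remOut D t u)) ∧ c u

  counted-sound : ∀ c s u → counted c s u ≡ true → toℕ u < t × s ≤ remOut D t u × c u ≡ true
  counted-sound c s u h with ∧-elim {(toℕ u <ᵇ t) ∧ (s ≤ᵇ remOut D t u)} h
  ... | early∧large , cu with ∧-elim {toℕ u <ᵇ t} early∧large
  ...   | early , large = <ᵇ-sound {toℕ u} early , ≤ᵇ-sound {s} large , cu

  counted-intro : ∀ c {s u} → toℕ u < t → s ≤ remOut D t u → c u ≡ true → counted c s u ≡ true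
  counted-intro c u<t s≤r cu = ∧-intro (∧-intro (<ᵇ-true u<t) (≤ᵇ-true s≤r)) cu

  potAmong : (Fin n → Bool) → ℕ → ℕ
  potAmong c s = count (counted c s)

  potNbrs potOthers : ℕ → ℕ
  potNbrs   = potAmong (λ u → arc D u k)
  potOthers = potAmong (λ u → not (arc D u k))

  pot≡potNbrs+potOthers : ∀ s → pot D t s ≡ potNbrs s + potOthers s
  pot≡potNbrs+potOthers s = count-split _ (λ u → arc D u k)

  pot-suc : ∀ j → pot D (suc t) j ≡ potNbrs (suc j) + potOthers j + ind≤ j (outdeg D k)
  pot-suc j = begin
    pot D (suc t) j
      ≡⟨ count-before k (λ u → j ≤ᵇ remOut D (suc t) u) ⟩
    count early + ind (j ≤ᵇ remOut D (suc t) k)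
      ≡⟨ cong₂ _+_ (count-split early (λ u → arc D u k)) (cong (ind≤ j) (remOut-after-self D k)) ⟩
    count (λ u → early u ∧ arc D u k) + count (λ u → early u ∧ not (arc D u k)) + ind≤ j (outdeg D k)
      ≡⟨ cong (_+ ind≤ j (outdeg D k)) (cong₂ _+_ (count-cong in-nbr) (count-cong other)) ⟩
    potNbrs (suc j) + potOthers j + ind≤ j (outdeg D k) ∎
    where
      open ≡-Reasoning
      early : Fin n → Bool
      early u = (toℕ u <ᵇ t) ∧ (j ≤ᵇ remOut D (suc t) u)
      in-nbr : ∀ u → early u ∧ arc D u k ≡ counted (λ u → arc D u k) (suc j) u
      in-nbr u with arc D u k in u→k
      ... | true  rewrite remOut-step u | u→k | suc-≤ᵇ-suc {j} {remOut D (suc t) u} = refl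
      ... | false = trans (∧-zeroʳ _) (sym (∧-zeroʳ _))
      other : ∀ u → early u ∧ not (arc D u k) ≡ counted (λ u → not (arc D u k)) j u
      other u with arc D u k in u→k
      ... | true  = trans (∧-zeroʳ _) (sym (∧-zeroʳ _))
      ... | false rewrite remOut-step u | u→k = refl

  potAmong-antitone : ∀ c s → potAmong c (suc s) ≤ potAmong c s
  potAmong-antitone c s = count-mono weaken
    where
      weaken : ∀ u → counted c (suc s) u ≡ true → counted c s u ≡ true
      weaken u h with counted-sound c (suc s) u h
      ... | u<t , 1+s≤r , cu = counted-intro c u<t (≤-trans (n≤1+n s) 1+s≤r) cu

  potNbrs≤indeg : ∀ s → potNbrs s ≤ indeg D k
  potNbrs≤indeg s = count-∧-≤ (λ u → (toℕ u <ᵇ t) ∧ (s ≤ᵇ remOut D t u)) (λ u → arc D u k)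

  threshold : WellConnectedAt D k → ∀ s → potOthers s ≡ 0 ⊎ potNbrs s ≡ indeg D k
  threshold wc s with potOthers s ≟ 0
  ... | yes none = inj₁ none
  ... | no  some with count-nonzero (counted (λ u → not (arc D u k)) s) some
  ...   | w , w-counted with counted-sound (λ u → not (arc D u k)) s w w-counted
  ...     | w<t , s≤rw , not-w→k = inj₂ (≤-antisym (potNbrs≤indeg s) (count-mono all-in))
    where
      w↛k : arc D w k ≡ false
      w↛k = trans (sym (not-involutive _)) (cong not not-w→k)
      all-in : ∀ u → arc D u k ≡ true → counted (λ u → arc D u k) s u ≡ true
      all-in u u→k = counted-intro (λ u → arc D u k) (forward D u k u→k) (≤-trans s≤rw (wc u w u→k w<t w↛k)) u→k

  potNbrs-beyond : ∀ {Δ} → (∀ u → outdeg D u ≤ Δ) → potNbrs (suc Δ) ≡ 0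
  potNbrs-beyond {Δ} bounded = count-zero too-small
    where
      too-small : ∀ u → counted (λ u → arc D u k) (suc Δ) u ≡ false
      too-small u = ¬-not λ h → <⇒≱ (s≤s (≤-trans (remOut≤outdeg D t u) (bounded u)))
                                    (proj₁ (proj₂ (counted-sound (λ u → arc D u k) (suc Δ) u h)))

deficit : ∀ {n} → Dag n → Fin n → ℕ
deficit D k = sum (λ y → if arc D y k then 0 else remOut D (toℕ k) y)

module Exchange {n} (D : Dag n) {u w k x : Fin n}
  (u→k : arc D u k ≡ true) (w↛k : arc D w k ≡ false)
  (w→x : arc D w x ≡ true) (u↛x : arc D u x ≡ false)
  (w<k : toℕ w < toℕ k) (k<x : toℕ k < toℕ x) where

  Corner : Fin n → Fin n → Set
  Corner y z = (y ≡ u ⊎ y ≡ w) × (z ≡ k ⊎ z ≡ x)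

  corner? : ∀ y z → Dec (Corner y z)
  corner? y z = ((y ≟ᶠ u) ⊎-dec (y ≟ᶠ w)) ×-dec ((z ≟ᶠ k) ⊎-dec (z ≟ᶠ x))

  flipped : Fin n → Fin n → Bool
  flipped y z = if does (corner? y z) then not (arc D y z) else arc D y z

  flipped-corner : ∀ {y z} → Corner y z → flipped y z ≡ not (arc D y z)
  flipped-corner {y} {z} c = cong (if_then not (arc D y z) else arc D y z) (dec-true (corner? y z) c)

  flipped-off : ∀ {y z} → ¬ Corner y z → flipped y z ≡ arc D y z
  flipped-off {y} {z} ¬c = cong (if_then not (arc D y z) else arc D y z) (dec-false (corner? y z) ¬c)

  off-rows : ∀ {y z} → y ≢ u → y ≢ w → ¬ Corner y z
  off-rows y≢u y≢w (inj₁ y≡u , _) = y≢u y≡u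
  off-rows y≢u y≢w (inj₂ y≡w , _) = y≢w y≡w

  off-columns : ∀ {y z} → z ≢ k → z ≢ x → ¬ Corner y z
  off-columns z≢k z≢x (_ , inj₁ z≡k) = z≢k z≡k
  off-columns z≢k z≢x (_ , inj₂ z≡x) = z≢x z≡x

  flipped-uk : flipped u k ≡ false
  flipped-uk = trans (flipped-corner (inj₁ refl , inj₁ refl)) (cong not u→k)

  flipped-ux : flipped u x ≡ true
  flipped-ux = trans (flipped-corner (inj₁ refl , inj₂ refl)) (cong not u↛x)

  flipped-wk : flipped w k ≡ true
  flipped-wk = trans (flipped-corner (inj₂ refl , inj₁ refl)) (cong not w↛k)

  flipped-wx : flipped w x ≡ false
  flipped-wx = trans (flipped-corner (inj₂ refl , inj₂ refl)) (cong not w→x)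

  u≢w : u ≢ w
  u≢w refl = contradiction (trans (sym u→k) w↛k) (λ ())

  k≢x : k ≢ x
  k≢x refl = <-irrefl refl k<x

  flipped-forward : ∀ y z → flipped y z ≡ true → toℕ y < toℕ z
  flipped-forward y z y→z with corner? y z
  ... | no ¬c = forward D y z (trans (sym (flipped-off ¬c)) y→z)
  ... | yes c = corner-forward c (trans (sym (flipped-corner c)) y→z)
    where
      corner-forward : ∀ {y z} → Corner y z → not (arc D y z) ≡ true → toℕ y < toℕ z
      corner-forward (inj₁ refl , inj₁ refl) h = contradiction (trans (sym (cong not u→k)) h) (λ ())
      corner-forward (inj₁ refl , inj₂ refl) _ = <-trans (forward D u k u→k) k<x
      corner-forward (inj₂ refl , inj₁ refl) _ = w<k
      corner-forward (inj₂ refl , inj₂ refl) h = contradiction (trans (sym (cong not w→x)) h) (λ ())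

  exchanged : Dag n
  exchanged = record { arc = flipped ; forward = flipped-forward }

  column : ∀ z → count (λ y → flipped y z) ≡ count (λ y → arc D y z)
  column z = by-cases (z ≟ᶠ k) (z ≟ᶠ x)
   where
    by-cases : Dec (z ≡ k) → Dec (z ≡ x) → count (λ y → flipped y z) ≡ count (λ y → arc D y z)
    by-cases (yes refl) _ = sym (count-exchange (λ y → arc D y k) (λ y → flipped y k) u≢w u→k w↛k flipped-uk flipped-wk
                             (λ y y≢u y≢w → sym (flipped-off (off-rows y≢u y≢w))))
    by-cases (no _) (yes refl) = sym (count-exchange (λ y → arc D y x) (λ y → flipped y x) (u≢w ∘ sym) w→x u↛x flipped-wx flipped-ux
                             (λ y y≢w y≢u → sym (flipped-off (off-rows y≢u y≢w))))
    by-cases (no z≢k) (no z≢x) = count-cong {n} (λ y → flipped-off {y} (off-columns z≢k z≢x))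

  row : (c : Fin n → Bool) → c k ≡ true → c x ≡ true →
    ∀ y → count (λ z → c z ∧ flipped y z) ≡ count (λ z → c z ∧ arc D y z)
  row c ck cx y = by-cases (y ≟ᶠ u) (y ≟ᶠ w)
   where
    by-cases : Dec (y ≡ u) → Dec (y ≡ w) → count (λ z → c z ∧ flipped y z) ≡ count (λ z → c z ∧ arc D y z)
    by-cases (yes refl) _ = sym (count-exchange (λ z → c z ∧ arc D u z) (λ z → c z ∧ flipped u z) k≢x
                             (∧-intro ck u→k) (cong₂ _∧_ cx u↛x) (cong₂ _∧_ ck flipped-uk) (∧-intro cx flipped-ux)
                             (λ z z≢k z≢x → cong (c z ∧_) (sym (flipped-off (off-columns z≢k z≢x)))))
    by-cases (no _) (yes refl) = sym (count-exchange (λ z → c z ∧ arc D w z) (λ z → c z ∧ flipped w z) (k≢x ∘ sym)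
                             (∧-intro cx w→x) (cong₂ _∧_ ck w↛k) (cong₂ _∧_ cx flipped-wx) (∧-intro ck flipped-wk)
                             (λ z z≢x z≢k → cong (c z ∧_) (sym (flipped-off (off-columns z≢k z≢x)))))
    by-cases (no y≢u) (no y≢w) = count-cong (λ z → cong (c z ∧_) (flipped-off (off-rows y≢u y≢w)))

  exchanged-degrees : SameDegrees exchanged D
  exchanged-degrees v = column v , row (λ _ → true) refl refl v

  exchanged-remOut : ∀ {p} → p ≤ toℕ k → ∀ y → remOut exchanged p y ≡ remOut D p y
  exchanged-remOut p≤k = row _ (≤ᵇ-true p≤k) (≤ᵇ-true (≤-trans p≤k (<⇒≤ k<x)))

  exchanged-wellConnectedAt : ∀ {v} → toℕ v < toℕ k → WellConnectedAt D v → WellConnectedAt exchanged v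
  exchanged-wellConnectedAt {v} v<k wc y z y→v z<v z↛v =
    subst₂ _≤_ (sym (exchanged-remOut v≤k z)) (sym (exchanged-remOut v≤k y))
      (wc y z (trans (sym (unchanged y)) y→v) z<v (trans (sym (unchanged z)) z↛v))
    where
      v≤k : toℕ v ≤ toℕ k
      v≤k = <⇒≤ v<k
      unchanged : ∀ y → flipped y v ≡ arc D y v
      unchanged y = flipped-off (off-columns (λ { refl → <-irrefl refl v<k })
                                            (λ { refl → <-irrefl refl (<-trans v<k k<x) }))

  exchanged-deficit : remOut D (toℕ k) u < remOut D (toℕ k) w → deficit exchanged k < deficit D k
  exchanged-deficit u<w = +-cancelʳ-< (r w) (sum g) (sum f) (begin-strict
    sum g + r w   ≡⟨ balance ⟨
    sum f + r u   <⟨ +-monoʳ-< (sum f) u<w ⟩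
    sum f + r w   ∎)
    where
      open ≤-Reasoning
      r : Fin n → ℕ
      r = remOut D (toℕ k)
      f g : Fin n → ℕ
      f y = if arc D y k then 0 else r y
      g y = if flipped y k then 0 else remOut exchanged (toℕ k) y
      agree : ∀ y → y ≢ u → y ≢ w → f y ≡ g y
      agree y y≢u y≢w = cong₂ (λ b m → if b then 0 else m)
        (sym (flipped-off (off-rows y≢u y≢w))) (sym (exchanged-remOut ≤-refl y))
      balance : sum f + r u ≡ sum g + r w
      balance = begin-equality
        sum f + r u            ≡⟨ cong (sum f +_) (+-identityʳ (r u)) ⟨
        sum f + (r u + 0)      ≡⟨ cong₂ (λ a b → sum f + (a + b))
                                    (trans (cong (if_then 0 else remOut exchanged (toℕ k) u) flipped-uk)
                                           (exchanged-remOut ≤-refl u))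
                                    (cong (if_then 0 else remOut exchanged (toℕ k) w) flipped-wk) ⟨
        sum f + (g u + g w)    ≡⟨ sum-exchange f g u≢w agree ⟩
        sum g + (f u + f w)    ≡⟨ cong₂ (λ a b → sum g + (a + b))
                                    (cong (if_then 0 else r u) u→k) (cong (if_then 0 else r w) w↛k) ⟩
        sum g + r w            ∎

module Repair {n} (k : Fin n) where

  Violation : Dag n → Set
  Violation D = ∃ λ u → ∃ λ w → arc D u k ≡ true × toℕ w < toℕ k × arc D w k ≡ false ×
                                remOut D (toℕ k) u < remOut D (toℕ k) w

  violation? : ∀ D → Dec (Violation D)
  violation? D = any? λ u → any? λ w →
    (arc D u k ≟ᵇ true) ×-dec (toℕ w <? toℕ k) ×-dec (arc D w k ≟ᵇ false) ×-dec
    (remOut D (toℕ k) u <? remOut D (toℕ k) w)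

  no-violation : ∀ {D} → ¬ Violation D → WellConnectedAt D k
  no-violation ¬v u w u→k w<k w↛k = ≮⇒≥ (λ u<w → ¬v (u , w , u→k , w<k , w↛k , u<w))

  exchange-step : ∀ D → Violation D → Σ (Dag n) λ D′ →
    SameDegrees D′ D × (∀ v → toℕ v < toℕ k → WellConnectedAt D v → WellConnectedAt D′ v) ×
    deficit D′ k < deficit D k
  exchange-step D (u , w , u→k , w<k , w↛k , u<w) with remOut-<-witness D (toℕ k) u<w
  ... | x , k≤x , w→x , u↛x =
    exchanged , exchanged-degrees , (λ v → exchanged-wellConnectedAt) , exchanged-deficit u<w
    where
      k<x : toℕ k < toℕ x
      k<x = ≤∧≢⇒< k≤x (λ k≡x → contradiction
              (trans (sym w→x) (subst (λ z → arc D w z ≡ false) (toℕ-injective k≡x) w↛k)) (λ ()))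
      open Exchange D u→k w↛k w→x u↛x w<k k<x

  repair : ∀ D → Acc _<_ (deficit D k) → WellConnectedBelow (toℕ k) D →
    Σ (Dag n) λ D′ → SameDegrees D′ D × WellConnectedBelow (suc (toℕ k)) D′
  repair D (acc smaller) wc with violation? D
  ... | no ¬v = D , SameDegrees-refl {D = D} , wellConnectedBelow-suc {D = D} {k} wc (no-violation {D} ¬v)
  ... | yes v with exchange-step D v
  ...   | D′ , same′ , keep , lower with repair D′ (smaller lower) (λ v v<k → keep v v<k (wc v v<k))
  ...     | D″ , same″ , wc″ = D″ , SameDegrees-trans {D₁ = D″} {D′} {D} same″ same′ , wc″

Rewiring : ∀ {n} → Dag n → ℕ → Set
Rewiring {n} D₀ t = Σ (Dag n) λ D → SameDegrees D D₀ × WellConnectedBelow t D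

rewire : ∀ {n} (D₀ : Dag n) t → t ≤ n → Rewiring D₀ t
rewire D₀ zero    _   = D₀ , SameDegrees-refl {D = D₀} , (λ v ())
rewire D₀ (suc t) t<n = extend (fromℕ< t<n) (toℕ-fromℕ< t<n) (rewire D₀ t (<⇒≤ t<n))
  where
    extend : ∀ k {s} → toℕ k ≡ s → Rewiring D₀ s → Rewiring D₀ (suc s)
    extend k refl (D , same , wc) with Repair.repair k D (<-wellFounded _) wc
    ... | D′ , same′ , wc′ = D′ , SameDegrees-trans {D₁ = D′} {D} {D₀} same′ same , wc′

lemma4 : (n Δ : ℕ) (D₀ : Dag n) →
    (∀ v → indeg D₀ v ≤ Δ × outdeg D₀ v ≤ Δ) →
    Σ (Dag n) λ D →
      WellConnected D ×
      (∀ v → indeg D v ≡ indeg D₀ v × outdeg D v ≡ outdeg D₀ v) ×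
      (∀ (k : Fin n) (j : ℕ) → 1 ≤ toℕ k → 1 ≤ j → j ≤ Δ →
        (j < Δ → indeg D k ≤ pot D (toℕ k) (suc j) →
          pot D (suc (toℕ k)) j ≡ pot D (toℕ k) j + ind≤ j (outdeg D k)) ×
        (j < Δ → pot D (toℕ k) (suc j) < indeg D k → indeg D k ≤ pot D (toℕ k) j →
          pot D (suc (toℕ k)) j
            ≡ (pot D (toℕ k) j ∸ (indeg D k ∸ pot D (toℕ k) (suc j))) + ind≤ j (outdeg D k)) ×
        (j < Δ → pot D (toℕ k) j < indeg D k →
          pot D (suc (toℕ k)) j ≡ pot D (toℕ k) (suc j) + ind≤ j (outdeg D k)) ×
        (j ≡ Δ →
          pot D (suc (toℕ k)) j ≡ (pot D (toℕ k) j ∸ indeg D k) + ind≤ j (outdeg D k)))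
lemma4 n Δ D₀ bounded with rewire D₀ n ≤-refl
... | D , same , below-n = D , wellConnected , same , λ k j _ _ _ →
  let open PotentialSplit D k
      open ThresholdSplit potNbrs potOthers (pot D t) (indeg D k) pot≡potNbrs+potOthers potNbrs≤indeg
             (potAmong-antitone _) (potAmong-antitone _) (threshold (wellConnected k))
      step : ∀ {m} → potNbrs (suc j) + potOthers j ≡ m → pot D (suc t) j ≡ m + ind≤ j (outdeg D k)
      step e = trans (pot-suc j) (cong (_+ ind≤ j (outdeg D k)) e)
  in (λ _ → step ∘ step-above) ,
     (λ _ p<d d≤p → step (step-between p<d d≤p)) ,
     (λ _ → step ∘ step-below) ,
     (λ j≡Δ → step (step-top (subst (λ i → potNbrs (suc i) ≡ 0) (sym j≡Δ) (potNbrs-beyond outdeg≤Δ))))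
  where
    wellConnected : WellConnected D
    wellConnected v = below-n v (toℕ<n v)

    outdeg≤Δ : ∀ v → outdeg D v ≤ Δ
    outdeg≤Δ v = subst (_≤ Δ) (sym (proj₂ (same v))) (proj₂ (bounded v))
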